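{- Let $k \ge 3$ and let $p_1, r, d$ be positive integers. (i) Suppose that $p_1 r^j + j d$ is prime for every $j = 0, 1, \dots, k-1$. Then $d$ is even, $p_1$ is an odd prime with $\gcd(p_1, d) = 1$, and $r$ is odd with $\gcd(r, d) = 1$. Moreover, if $r \ne 1$ then $k \le \min(p_1, r_1)$, where $r_1$ denotes the smallest prime factor of $r$; and if $r = 1$ then $k \le p_1$. (ii) Suppose $p_1 = 1$, $r \ne 1$, and $r^j + j d$ is prime for every $j = 1, 2, \dots, k$ (the term for $j=0$, which equals $1$, is excluded). Then $k \le r_1 - 1$, where $r_1$ is the smallest prime factor of $r$.
   Context: A geometric-arithmetic progression of primes of order $k$ (GAP-$k$) with start $p_1$, ratio $r$ and difference $d$ is a set of $k$ primes of the form $p_1 r^j + j d$ for consecutive $j$ (normally $j=0,\dots,k-1$, giving $p_1, p_1 r + d, p_1 r^2 + 2d, \dots$). When $p_1 = 1$ the initial term $1$ is not counted, since $1$ is not prime. -}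

module Defs where

open import Data.Nat using (ℕ; _+_; _*_; _^_; _≤_)
open import Data.Nat.Divisibility using (_∣_)
open import Data.Nat.Primality using (Prime)
open import Data.Product using (_×_)

gapTerm : ℕ → ℕ → ℕ → ℕ → ℕ
gapTerm p₁ r d j = p₁ * r ^ j + j * d

IsSmallestPrimeFactor : ℕ → ℕ → Set
IsSmallestPrimeFactor q n = Prime q × q ∣ n × (∀ q′ → Prime q′ → q′ ∣ n → q ≤ q′)

-- Every term p₁ r^j + j d splits into two positive summands, so a prime term admits no
-- common divisor m > 1 of p₁ r^j and j d. Taking j = 1 gives gcd(p₁, d) = gcd(r, d) = 1;
-- taking j = m for a prime m dividing p₁ or r (in particular m = 2, m = p₁, m = r₁) shows
-- that the term with index m is composite, which bounds k and forces p₁ and r to be odd.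
-- Finally p₁ r + d is an odd prime with p₁ r odd, so d is even.
module Submission where

open import Defs
open import Data.Nat using (ℕ; _+_; _∸_; _≤_; _<_; _*_; _^_; suc; s≤s; z≤n; _%_)
open import Data.Nat.Divisibility
  using (_∣_; _∣?_; ∣m∣n⇒∣m+n; ∣⇒≤; m%n≡0⇒n∣m; ∣-trans; m∣m*n; n∣m*n)
open import Data.Nat.Primality using (Prime; prime[2]; euclidsLemma; prime⇒irreducible; prime⇒nonTrivial)
open import Data.Nat.Base using (nonTrivial⇒n>1; >-nonZero)
open import Data.Nat.GCD using (gcd; gcd[m,n]∣m; gcd[m,n]∣n)
open import Data.Nat.Properties
open import Data.Nat.DivMod using (m%n<n; %-distribˡ-+)
open import Data.Product using (_×_; _,_)
open import Data.Sum using (inj₁; inj₂; [_,_]′)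
open import Relation.Binary.PropositionalEquality
  using (_≡_; _≢_; refl; sym; trans; cong; cong₂; subst; module ≡-Reasoning)
open import Relation.Nullary using (¬_; yes; no; contradiction)
open import Function using (_∘_)

prime⇒1< : ∀ {p} → Prime p → 1 < p
prime⇒1< {p} pr = nonTrivial⇒n>1 p {{prime⇒nonTrivial pr}}

prime[m+n]∧∣m∧∣n⇒≡1 : ∀ {m n q} → Prime (m + n) → 0 < m → 0 < n → q ∣ m → q ∣ n → q ≡ 1
prime[m+n]∧∣m∧∣n⇒≡1 {m} {n} pr m>0 n>0 q∣m q∣n
  with prime⇒irreducible pr (∣m∣n⇒∣m+n q∣m q∣n)
... | inj₁ q≡1 = q≡1
... | inj₂ refl = contradiction (∣⇒≤ {{>-nonZero n>0}} q∣n) (<⇒≱ (m<n+m n m>0))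

2∤n⇒n%2≡1 : ∀ {n} → ¬ 2 ∣ n → n % 2 ≡ 1
2∤n⇒n%2≡1 {n} 2∤n with n % 2 in eq | m%n<n n 2
... | 0           | _ = contradiction (m%n≡0⇒n∣m n 2 eq) 2∤n
... | 1           | _ = refl
... | suc (suc _) | s≤s (s≤s ())

2∤m∧2∤n⇒2∣m+n : ∀ {m n} → ¬ 2 ∣ m → ¬ 2 ∣ n → 2 ∣ m + n
2∤m∧2∤n⇒2∣m+n {m} {n} 2∤m 2∤n = m%n≡0⇒n∣m (m + n) 2 (begin
  (m + n) % 2           ≡⟨ %-distribˡ-+ m n 2 ⟩
  (m % 2 + n % 2) % 2   ≡⟨ cong₂ (λ a b → (a + b) % 2) (2∤n⇒n%2≡1 2∤m) (2∤n⇒n%2≡1 2∤n) ⟩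
  0                     ∎)
  where open ≡-Reasoning

2∤m∧2∤n⇒2∤m*n : ∀ {m n} → ¬ 2 ∣ m → ¬ 2 ∣ n → ¬ 2 ∣ m * n
2∤m∧2∤n⇒2∤m*n {m} {n} 2∤m 2∤n = [ 2∤m , 2∤n ]′ ∘ euclidsLemma m n prime[2]

prime[m+n]∧2∤m⇒2∣n : ∀ {m n} → Prime (m + n) → 1 < m → 0 < n → ¬ 2 ∣ m → 2 ∣ n
prime[m+n]∧2∤m⇒2∣n {m} {n} pr m>1 n>0 2∤m with 2 ∣? n
... | yes 2∣n = 2∣n
... | no 2∤n with prime⇒irreducible pr (2∤m∧2∤n⇒2∣m+n 2∤m 2∤n)
...   | inj₁ ()
...   | inj₂ 2≡m+n = contradiction (subst (3 ≤_) (sym 2≡m+n) (+-mono-≤ m>1 n>0)) (<⇒≱ ≤-refl)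

gapTerm[0] : ∀ p₁ r d → gapTerm p₁ r d 0 ≡ p₁
gapTerm[0] p₁ r d = trans (+-identityʳ (p₁ * 1)) (*-identityʳ p₁)

gapTerm[1] : ∀ p₁ r d → gapTerm p₁ r d 1 ≡ p₁ * r + d
gapTerm[1] p₁ r d = cong₂ _+_ (cong (p₁ *_) (*-identityʳ r)) (+-identityʳ d)

∣r⇒∣p₁*r^j : ∀ {q r} p₁ j → 0 < j → q ∣ r → q ∣ p₁ * r ^ j
∣r⇒∣p₁*r^j {r = r} p₁ (suc j) _ q∣r = ∣-trans q∣r (∣-trans (m∣m*n (r ^ j)) (n∣m*n p₁))

module _ {p₁ r d : ℕ} (p₁>0 : 0 < p₁) (r>0 : 0 < r) (d>0 : 0 < d) where

  gapTerm-coprime : ∀ j {q} → 0 < j → Prime (gapTerm p₁ r d j) →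
                    q ∣ p₁ * r ^ j → q ∣ j * d → q ≡ 1
  gapTerm-coprime j j>0 pr =
    prime[m+n]∧∣m∧∣n⇒≡1 pr (*-mono-≤ p₁>0 (m^n>0 r {{>-nonZero r>0}} j)) (*-mono-≤ j>0 d>0)

  gapTerm-composite : ∀ {q} → 1 < q → q ∣ p₁ * r ^ q → ¬ Prime (gapTerm p₁ r d q)
  gapTerm-composite q>1 q∣p₁r^q pr = >⇒≢ q>1 (gapTerm-coprime _ (<⇒≤ q>1) pr q∣p₁r^q (m∣m*n d))

  length≤divisor : ∀ {k q} → (∀ j → j < k → Prime (gapTerm p₁ r d j)) →
                   1 < q → q ∣ p₁ * r ^ q → k ≤ q
  length≤divisor primes q>1 q∣p₁r^q = ≮⇒≥ λ q<k → gapTerm-composite q>1 q∣p₁r^q (primes _ q<k)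

module PrimeProgression {k p₁ r d : ℕ} (3≤k : 3 ≤ k) (p₁>0 : 0 < p₁) (r>0 : 0 < r) (d>0 : 0 < d)
                        (primes : ∀ j → j < k → Prime (gapTerm p₁ r d j)) where

  private
    1<k : 1 < k
    1<k = ≤-trans (s≤s (s≤s z≤n)) 3≤k

    length≤ : ∀ {q} → 1 < q → q ∣ p₁ * r ^ q → k ≤ q
    length≤ = length≤divisor p₁>0 r>0 d>0 primes

    coprime : ∀ {q} → q ∣ p₁ * r ^ 1 → q ∣ 1 * d → q ≡ 1
    coprime = gapTerm-coprime p₁>0 r>0 d>0 1 (s≤s z≤n) (primes 1 1<k)

  p₁-prime : Prime p₁
  p₁-prime = subst Prime (gapTerm[0] p₁ r d) (primes 0 (<-trans (s≤s z≤n) 1<k))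

  2∤p₁ : ¬ 2 ∣ p₁
  2∤p₁ 2∣p₁ = <⇒≱ 3≤k (length≤ (s≤s (s≤s z≤n)) (∣-trans 2∣p₁ (m∣m*n (r ^ 2))))

  2∤r : ¬ 2 ∣ r
  2∤r 2∣r = <⇒≱ 3≤k (length≤ (s≤s (s≤s z≤n)) (∣r⇒∣p₁*r^j p₁ 2 (s≤s z≤n) 2∣r))

  2∣d : 2 ∣ d
  2∣d = prime[m+n]∧2∤m⇒2∣n (subst Prime (gapTerm[1] p₁ r d) (primes 1 1<k))
          (*-mono-≤ (prime⇒1< p₁-prime) r>0) d>0 (2∤m∧2∤n⇒2∤m*n 2∤p₁ 2∤r)

  gcd[p₁,d]≡1 : gcd p₁ d ≡ 1
  gcd[p₁,d]≡1 = coprime (∣-trans (gcd[m,n]∣m p₁ d) (m∣m*n (r ^ 1)))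
                        (∣-trans (gcd[m,n]∣n p₁ d) (n∣m*n 1))

  gcd[r,d]≡1 : gcd r d ≡ 1
  gcd[r,d]≡1 = coprime (∣r⇒∣p₁*r^j p₁ 1 (s≤s z≤n) (gcd[m,n]∣m r d))
                       (∣-trans (gcd[m,n]∣n r d) (n∣m*n 1))

  k≤p₁ : k ≤ p₁
  k≤p₁ = length≤ (prime⇒1< p₁-prime) (m∣m*n (r ^ p₁))

  k≤prime-factor : ∀ {q} → Prime q → q ∣ r → k ≤ q
  k≤prime-factor {q} q-prime q∣r = length≤ q>1 (∣r⇒∣p₁*r^j p₁ q (<⇒≤ q>1) q∣r)
    where
    q>1 : 1 < q
    q>1 = prime⇒1< q-prime

length<prime-factor : ∀ {k r d q} → 0 < r → 0 < d →
                      (∀ j → 1 ≤ j → j ≤ k → Prime (gapTerm 1 r d j)) → Prime q → q ∣ r → k < q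
length<prime-factor {q = q} r>0 d>0 primes q-prime q∣r = ≰⇒> λ q≤k →
  gapTerm-composite {p₁ = 1} (s≤s z≤n) r>0 d>0 q>1 (∣r⇒∣p₁*r^j 1 q (<⇒≤ q>1) q∣r) (primes q (<⇒≤ q>1) q≤k)
  where
  q>1 : 1 < q
  q>1 = prime⇒1< q-prime

theorem1 : (k p₁ r d : ℕ) → 3 ≤ k → 1 ≤ p₁ → 1 ≤ r → 1 ≤ d →
    ((∀ j → j < k → Prime (gapTerm p₁ r d j)) →
      (2 ∣ d) × Prime p₁ × (¬ 2 ∣ p₁) × (gcd p₁ d ≡ 1) ×
      (¬ 2 ∣ r) × (gcd r d ≡ 1) ×
      (r ≢ 1 → ∀ r₁ → IsSmallestPrimeFactor r₁ r → k ≤ p₁ × k ≤ r₁) ×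
      (r ≡ 1 → k ≤ p₁))
    ×
    (p₁ ≡ 1 → r ≢ 1 → (∀ j → 1 ≤ j → j ≤ k → Prime (gapTerm 1 r d j)) →
      ∀ r₁ → IsSmallestPrimeFactor r₁ r → k ≤ r₁ ∸ 1)
theorem1 k p₁ r d 3≤k p₁>0 r>0 d>0 = part-i , part-ii
  where
  part-i : (∀ j → j < k → Prime (gapTerm p₁ r d j)) →
           (2 ∣ d) × Prime p₁ × (¬ 2 ∣ p₁) × (gcd p₁ d ≡ 1) ×
           (¬ 2 ∣ r) × (gcd r d ≡ 1) ×
           (r ≢ 1 → ∀ r₁ → IsSmallestPrimeFactor r₁ r → k ≤ p₁ × k ≤ r₁) ×
           (r ≡ 1 → k ≤ p₁)
  part-i primes = 2∣d , p₁-prime , 2∤p₁ , gcd[p₁,d]≡1 , 2∤r , gcd[r,d]≡1 ,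
                  (λ _ r₁ (r₁-prime , r₁∣r , _) → k≤p₁ , k≤prime-factor r₁-prime r₁∣r) ,
                  (λ _ → k≤p₁)
    where open PrimeProgression 3≤k p₁>0 r>0 d>0 primes

  part-ii : p₁ ≡ 1 → r ≢ 1 → (∀ j → 1 ≤ j → j ≤ k → Prime (gapTerm 1 r d j)) →
            ∀ r₁ → IsSmallestPrimeFactor r₁ r → k ≤ r₁ ∸ 1
  part-ii _ _ primes r₁ (r₁-prime , r₁∣r , _) =
    ∸-monoˡ-≤ 1 (length<prime-factor r>0 d>0 primes r₁-prime r₁∣r)
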